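{- Given a framed graph $G$, the set of Danilov-Karzanov-Koshevoy triangulations of the flow polytope $\mathcal{F}_G$ is a subset of the set of framed Postnikov-Stanley triangulations of $\mathcal{F}_G$.
   Context: Let $G$ be a connected (multi)graph on the vertex set $[n]$ with edges directed from smaller to larger vertex, such that every vertex $v\in[2,n-1]$ has both incoming and outgoing edges. The flow polytope $\mathcal{F}_G$ is the set of functions $fl:E(G)\to\mathbb{R}_{\geq 0}$ with total outflow $1$ at vertex $1$, total inflow $1$ at vertex $n$, and inflow equal to outflow at each vertex $2,\dots,n-1$. Routes are maximal directed paths from $1$ to $n$; the vertices of $\mathcal{F}_G$ are the unit flows along routes. A framing of $G$ is a choice, at each inner vertex $v$, of a linear order on the incoming edges of $v$ and a linear order on the outgoing edges of $v$; a framed graph is a graph with a framing. Danilov-Karzanov-Koshevoy triangulations: for a framed $G$ and inner vertex $v$, the maximal paths ending at $v$ are linearly ordered by: $P\prec Q$ iff, at the largest vertex $w$ after which $P,Q$ coincide and before which they differ, the edge of $P$ entering $w$ precedes the edge of $Q$ entering $w$ in the framing at $w$; maximal paths starting at $v$ are ordered analogously using outgoing edges. Two routes $P,Q$ are coherent at a common inner vertex $v$ if their initial segments ending at $v$ are ordered the same way as their final segments starting at $v$; they are coherent if coherent at every common inner vertex. A clique is a set of mutually coherent routes. For each framing, the convex hulls of the vertices of $\mathcal{F}_G$ corresponding to the routes of maximal cliques are the top-dimensional simplices of a (regular) triangulation of $\mathcal{F}_G$; these are the Danilov-Karzanov-Koshevoy triangulations. Framed Postnikov-Stanley triangulations: a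 bipartite noncrossing tree on ordered left vertices $x_1,\dots,x_\ell$ and ordered right vertices $x_{\ell+1},\dots,x_{\ell+r}$ is a tree with no pair of edges $(x_p,x_{\ell+q}),(x_t,x_{\ell+u})$ with $p<t$, $q>u$. A reduction at vertex $i$ of a framed graph takes the incoming edges $\mathcal{I}_i$ and outgoing edges $\mathcal{O}_i$ of $i$ (ordered by the framing) and, for each bipartite noncrossing tree $T$ on left set $\mathcal{I}_i$ and right set $\mathcal{O}_i$, forms the graph $G^{(i)}_T$ obtained by deleting $i$ and its incident edges and adding, for each tree edge $((r,i),(i,s))$, the edge $(r,s)$ (the "sum" of the two edges). $G^{(i)}_T$ gets the inheritance framing: at each vertex $j>i$ the outgoing edges keep their order; each incoming edge of $j$ in $G^{(i)}_T$ is a sum involving exactly one original incoming edge $m_l$ of $j$; letting $S(m_l)$ be those edges, edges within $S(m_l)$ are ordered top to bottom as their tree edges appear in $T$ (drawn with left and right vertices listed vertically in order), and every edge of $S(m_p)$ precedes every edge of $S(m_q)$ when $m_p$ precedes $m_q$ in the framing of $G$; edges at vertices smaller than $i$ are ordered arbitrarily. Performing reductions successively at vertices $2,3,\dots,n-1$ (each time on all resulting graphs with their inheritance framings) yields graphs on vertices $1,n$ with $\#E(G)-n+2$ edges each, whose flow polytopes are simplices that together triangulate $\mathcal{F}_G$; these are the framed Postnikov-Stanley triangulations. -}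

module Defs where

open import Data.Nat using (ℕ; zero; suc; _+_; _≤_; _<_; _≡ᵇ_; _<ᵇ_)
open import Data.Nat.Properties using ()
open import Data.Fin using (Fin; toℕ)
open import Data.Bool using (Bool; true; false; if_then_else_; _∧_)
open import Data.List using (List; []; _∷_; [_]; _++_; map; concatMap; filterᵇ; length; lookup; reverse; allFin; cartesianProduct)
open import Data.List.Properties using (≡-dec)
open import Data.List.Membership.Propositional using (_∈_)
open import Data.List.Relation.Unary.All using (All)
open import Data.List.Relation.Unary.Unique.Propositional using (Unique)
open import Data.Product using (Σ; ∃; _×_; _,_; proj₁; proj₂)
open import Data.Sum using (_⊎_; inj₁; inj₂)
open import Relation.Nullary using (¬_)
open import Relation.Nullary.Decidable using (⌊_⌋)
open import Relation.Binary.PropositionalEquality using (_≡_)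
open import Function using (_⇔_)
import Data.Fin as Fin

-- Multigraphs on the vertex set [n] = {1,…,n}; edges are indexed by Fin m,
-- edge e goes from tl e to hd e.

record Graph : Set where
  field
    n  : ℕ
    m  : ℕ
    tl : Fin m → ℕ
    hd : Fin m → ℕ

module _ (G : Graph) where
  open Graph G

  Edge : Set
  Edge = Fin m

  -- a path is a list of edges; we also use lists of edges for edges of
  -- intermediate graphs in the reduction process (the "sum" of edges).
  Path : Set
  Path = List Edge

  Inner : ℕ → Set
  Inner v = 2 ≤ v × v < n

  data Conn (u : ℕ) : ℕ → Set where
    c-refl : Conn u u
    c-fwd  : (e : Edge) → Conn u (tl e) → Conn u (hd e)
    c-bwd  : (e : Edge) → Conn u (hd e) → Conn u (tl e)

  record WellFormed : Set where
    field
      tl-≥1      : ∀ e → 1 ≤ tl e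
      tl<hd      : ∀ e → tl e < hd e
      hd-≤n      : ∀ e → hd e ≤ n
      connected  : ∀ u v → 1 ≤ u → u ≤ n → 1 ≤ v → v ≤ n → Conn u v
      has-in     : ∀ v → Inner v → ∃ λ e → hd e ≡ v
      has-out    : ∀ v → Inner v → ∃ λ e → tl e ≡ v

  data PathFT : ℕ → ℕ → Path → Set where
    single : (e : Edge) → PathFT (tl e) (hd e) [ e ]
    cons   : (e : Edge) {b : ℕ} {p : Path} → PathFT (hd e) b p → PathFT (tl e) b (e ∷ p)

  Route : Path → Set
  Route P = PathFT 1 n P

  -- A framing: at each vertex v, a list giving the linear order of the
  -- incoming (resp. outgoing) edges; only constrained at inner vertices.
  record Framing : Set where
    field
      inOrd  : ℕ → List Edge
      outOrd : ℕ → List Edge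

  record IsFraming (F : Framing) : Set where
    open Framing F
    field
      in-unique  : ∀ v → Inner v → Unique (inOrd v)
      in-exact   : ∀ v → Inner v → ∀ e → (e ∈ inOrd v) ⇔ (hd e ≡ v)
      out-unique : ∀ v → Inner v → Unique (outOrd v)
      out-exact  : ∀ v → Inner v → ∀ e → (e ∈ outOrd v) ⇔ (tl e ≡ v)

  Prec : List Edge → Edge → Edge → Set
  Prec L e f = Σ (List Edge) λ xs → Σ (List Edge) λ ys → Σ (List Edge) λ zs →
               L ≡ xs ++ (e ∷ ys ++ (f ∷ zs))

  module _ (F : Framing) where
    open Framing F

    -- Order on paths ending at a common vertex, given as REVERSED edge lists:
    -- skip the common final segment, then compare the edges entering the
    -- vertex w where they first differ, via the framing at w.
    data InLess : Path → Path → Set where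
      here  : ∀ {e f p q} → Prec (inOrd (hd e)) e f → InLess (e ∷ p) (f ∷ q)
      there : ∀ {e p q} → InLess p q → InLess (e ∷ p) (e ∷ q)

    data OutLess : Path → Path → Set where
      here  : ∀ {e f p q} → Prec (outOrd (tl e)) e f → OutLess (e ∷ p) (f ∷ q)
      there : ∀ {e p q} → OutLess p q → OutLess (e ∷ p) (e ∷ q)

    Split : ℕ → Path → Path → Path → Set
    Split v P P₁ P₂ = (P ≡ P₁ ++ P₂) × PathFT 1 v P₁ × PathFT v n P₂

    Coherent : Path → Path → Set
    Coherent P Q = ∀ v P₁ P₂ Q₁ Q₂ → Split v P P₁ P₂ → Split v Q Q₁ Q₂ →
      ¬ (InLess (reverse P₁) (reverse Q₁) × OutLess Q₂ P₂) ×
      ¬ (InLess (reverse Q₁) (reverse P₁) × OutLess P₂ Q₂)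

    record MaxClique (S : List Path) : Set where
      field
        routes   : All Route S
        clique   : ∀ P Q → P ∈ S → Q ∈ S → Coherent P Q
        maximal  : ∀ R → Route R → (∀ P → P ∈ S → Coherent R P) → R ∈ S

    -- T p q = true means the tree contains the edge (x_p , x_{ℓ+q})
    data BConn {ℓ r : ℕ} (T : Fin ℓ → Fin r → Bool) (x : Fin ℓ ⊎ Fin r) :
         Fin ℓ ⊎ Fin r → Set where
      b-refl : BConn T x x
      b-lr   : ∀ p q → T p q ≡ true → BConn T x (inj₁ p) → BConn T x (inj₂ q)
      b-rl   : ∀ p q → T p q ≡ true → BConn T x (inj₂ q) → BConn T x (inj₁ p)

    numEdges : {ℓ r : ℕ} → (Fin ℓ → Fin r → Bool) → ℕ
    numEdges {ℓ} {r} T =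
      length (filterᵇ (λ pq → T (proj₁ pq) (proj₂ pq)) (cartesianProduct (allFin ℓ) (allFin r)))

    record BNCTree {ℓ r : ℕ} (T : Fin ℓ → Fin r → Bool) : Set where
      field
        connected   : ∀ x y → BConn T x y
        edge-count  : numEdges T + 1 ≡ ℓ + r
        noncrossing : ∀ p t q u → T p q ≡ true → T t u ≡ true →
                      toℕ p < toℕ t → ¬ (toℕ u < toℕ q)

    -- state of the reduction process: for each vertex j, the ordered list of
    -- incoming edges of j, each edge recorded as the path of G it is a sum of.
    -- (Outgoing edges of a not-yet-reduced vertex are always the original
    -- ones, in the order of the framing.)
    State : Set
    State = ℕ → List Path

    initial : State
    initial j = if j <ᵇ n then map [_] (inOrd j)
                else map [_] (filterᵇ (λ e → hd e ≡ᵇ j) (allFin m))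

    startsAt : ℕ → Path → Bool
    startsAt i []      = false
    startsAt i (e ∷ _) = tl e ≡ᵇ i

    -- reduction at vertex i with tree T; inheritance framing on incoming edges
    reduce : (i : ℕ) (In : State) →
             (Fin (length (In i)) → Fin (length (outOrd i)) → Bool) → State
    reduce i In T j = concatMap expand (In j)
      where
        expand : Path → List Path
        expand P = if startsAt i P
          then concatMap (λ q →
                 if ⌊ ≡-dec Fin._≟_ [ lookup (outOrd i) q ] P ⌋
                 then map (λ p → lookup (In i) p ++ P)
                          (filterᵇ (λ p → T p q) (allFin (length (In i))))
                 else [])
               (allFin (length (outOrd i)))
          else [ P ]

    data Run (i : ℕ) (In : State) : State → Set where
      done : n ≤ i → Run i In In
      step : i < n → (T : Fin (length (In i)) → Fin (length (outOrd i)) → Bool) →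
             BNCTree T → ∀ {Fn} → Run (suc i) (reduce i In T) Fn → Run i In Fn

    -- S is the vertex set (set of routes) of a top-dimensional simplex of the
    -- framed Postnikov–Stanley triangulation: the routes given by the edges
    -- (from 1 to n) of a final graph
    PSSimplex : List Path → Set
    PSSimplex S = Σ State λ Fn → Run 2 initial Fn × (∀ P → (P ∈ S) ⇔ (P ∈ Fn n))

{-# OPTIONS --safe #-}

-- The framing F itself gives the required Postnikov–Stanley triangulation.  Reducing the
-- vertices 2, …, n-1 in turn, record every incoming edge of a vertex j not yet reduced as the
-- path of G it is the sum of; under the inheritance framing these lists stay sorted in the DKK
-- order of paths ending at j.  A reduction at i with a noncrossing tree T joins the p-th
-- incoming path to the q-th outgoing edge exactly when T p q holds.  Hence two final routes
-- are never incoherent at i: their tree edges would cross.  Conversely a non-edge (p , q) of T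
-- is crossed by a tree edge, which extends to a final route incoherent with every route
-- through (p , q); so a route coherent with all final routes is final, and the final routes
-- form a maximal clique.  For a maximal clique S, the pairs (p , q) used by the routes of S
-- are noncrossing by coherence and extend to a noncrossing (staircase) tree; reducing with
-- these trees keeps S among the final routes, which by maximality are then exactly S.

module Submission where

open import Defs
open import Data.List using (List)
open import Data.Product using (Σ; _×_)
open import Function using (_⇔_)

open import Data.Bool using (Bool; true; false; T; T?; if_then_else_; _∧_)
open import Data.Bool.Properties using (T-≡; ∧-zeroʳ)
open import Data.Empty using (⊥; ⊥-elim)
open import Data.Fin using (Fin; zero; suc; toℕ; fromℕ<)
open import Data.Fin.Properties using (toℕ-injective; toℕ<n; toℕ-fromℕ<)
import Data.Fin.Properties as Fin
open import Data.List
  using ([]; _∷_; [_]; _++_; _∷ʳ_; initLast; _∷ʳ′_; map; concatMap; filterᵇ; length; lookup; reverse;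
         allFin; upTo; applyUpTo; tabulate; cartesianProduct)
open import Data.List.Extrema.Nat using (max; max≤v⁺; v≤max⁺; ⊥≤max)
open import Data.List.Membership.Propositional using (_∈_; find; lose)
open import Data.List.Membership.Propositional.Properties
  using (∈-map⁺; ∈-map⁻; ∈-++⁺ʳ; ∈-∃++; ∈-concatMap⁺; ∈-concatMap⁻; ∈-filter⁺; ∈-filter⁻; ∈-allFin; ∈-lookup;
         ∈-cartesianProduct⁺)
open import Data.List.Properties
  using (filter-++; length-++; map-tabulate; map-cong; tabulate-lookup; upTo-∷ʳ; ++-identityʳ; reverse-++;
         ∷ʳ-injective; ∷ʳ-++; ∷-injectiveˡ; ≡-dec)
open import Data.List.Relation.Unary.All as All using (All; []; _∷_)
import Data.List.Relation.Unary.AllPairs as AllPairs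
open AllPairs using (AllPairs; []; _∷_)
open import Data.List.Relation.Unary.AllPairs.Properties using (tabulate⁺-<; concat⁺)
  renaming (map⁺ to AllPairs-map⁺; filter⁺ to AllPairs-filter⁺)
open import Data.List.Relation.Unary.All.Properties using () renaming (map⁺ to All-map⁺)
import Data.List.Relation.Unary.Any as Any
open Any using (here; there; any?)
import Data.List.Relation.Binary.Pointwise as Pointwise
open Pointwise using (Pointwise-≡⇒≡)
import Data.List.Relation.Binary.Prefix.Heterogeneous as Prefix
open Prefix using (Prefix; toView; fromView)
open import Data.List.Relation.Binary.Prefix.Heterogeneous.Properties using (prefix?)
open import Data.List.Relation.Unary.Any.Properties using (lookup-index; reverse⁻)
open import Data.List.Relation.Unary.Unique.Propositional using (Unique)
open import Data.Nat using (ℕ; zero; suc; _+_; _∸_; _≤_; _<_; _≤ᵇ_; _<ᵇ_; _≡ᵇ_; z≤n; s≤s)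
open import Data.Nat.ListAction using (sum)
open import Data.Nat.Properties
open import Data.Product using (∃₂; ∃-syntax; _,_; proj₁; proj₂; swap)
open import Data.Sum using (_⊎_; inj₁; inj₂)
open import Function using (_∘_; case_of_; mk⇔; Equivalence)
open import Relation.Binary using (Tri; tri<; tri≈; tri>)
open import Relation.Binary.PropositionalEquality
  using (_≡_; _≢_; refl; sym; trans; cong; cong₂; subst; subst₂; ≢-sym; module ≡-Reasoning)
open import Relation.Nullary using (¬_; yes; no)
open import Relation.Nullary.Decidable using (⌊_⌋; toWitness; fromWitness)

private variable
  A B : Set

true≢false : true ≢ false
true≢false ()

module _ {R : A → A → Set} where

  AllPairs-lookup : ∀ {xs} → AllPairs R xs → ∀ {i j} → toℕ i < toℕ j → R (lookup xs i) (lookup xs j)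
  AllPairs-lookup (Rx ∷ _)  {zero}  {suc j} _         = All.lookup Rx (∈-lookup j)
  AllPairs-lookup (_ ∷ Rxs) {suc i} {suc j} (s≤s i<j) = AllPairs-lookup Rxs i<j

lookup-∈ : ∀ {x : A} {xs} → x ∈ xs → ∃[ k ] lookup xs k ≡ x
lookup-∈ x∈ = Any.index x∈ , sym (lookup-index x∈)

lookup-injective : ∀ {xs : List A} → Unique xs → ∀ {i j} → lookup xs i ≡ lookup xs j → i ≡ j
lookup-injective u {i} {j} eq with Fin.<-cmp i j
... | tri< i<j _ _ = ⊥-elim (AllPairs-lookup u i<j eq)
... | tri≈ _ i≡j _ = i≡j
... | tri> _ _ j<i = ⊥-elim (AllPairs-lookup u j<i (sym eq))

AllPairs-concatMap : ∀ {R : A → A → Set} {S : B → B → Set} (f : A → List B) {xs} →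
  (∀ x → AllPairs S (f x)) → (∀ {x y} → R x y → ∀ {a b} → a ∈ f x → b ∈ f y → S a b) →
  AllPairs R xs → AllPairs S (concatMap f xs)
AllPairs-concatMap f inside across Rxs = concat⁺ (All-map⁺ (All.universal inside _))
  (AllPairs-map⁺ (AllPairs.map (λ Rxy → All.tabulate λ a∈ → All.tabulate λ b∈ → across Rxy a∈ b∈)
                               Rxs))

Prefix⇒++ : ∀ {xs ys : List A} → Prefix _≡_ xs ys → ∃[ zs ] ys ≡ xs ++ zs
Prefix⇒++ pre with pw Prefix.++ zs ← toView pre = zs , cong (_++ zs) (sym (Pointwise-≡⇒≡ pw))

++⇒Prefix : ∀ (xs : List A) zs → Prefix _≡_ xs (xs ++ zs)
++⇒Prefix xs zs = fromView (Pointwise.refl refl Prefix.++ zs)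

module _ {f : A → List B} {xs : List A} {y : B} where

  ∈-concatMap-witness : y ∈ concatMap f xs → ∃[ x ] x ∈ xs × y ∈ f x
  ∈-concatMap-witness = find ∘ ∈-concatMap⁻ f

  ∈-concatMap-intro : ∀ {x} → x ∈ xs → y ∈ f x → y ∈ concatMap f xs
  ∈-concatMap-intro x∈ y∈ = ∈-concatMap⁺ f (lose x∈ y∈)

module _ {p : A → Bool} {xs : List A} {x : A} where

  ∈-filterᵇ⁻ : x ∈ filterᵇ p xs → x ∈ xs × p x ≡ true
  ∈-filterᵇ⁻ x∈ = let x∈xs , px = ∈-filter⁻ (T? ∘ p) x∈ in x∈xs , Equivalence.to T-≡ px

  ∈-filterᵇ⁺ : x ∈ xs → p x ≡ true → x ∈ filterᵇ p xs
  ∈-filterᵇ⁺ x∈xs px = ∈-filter⁺ (T? ∘ p) x∈xs (Equivalence.from T-≡ px)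

module _ {b : Bool} where

  T⇒≡true : T b → b ≡ true
  T⇒≡true = Equivalence.to T-≡

  ≡true⇒T : b ≡ true → T b
  ≡true⇒T = Equivalence.from T-≡

¬T⇒≡false : ∀ {b} → ¬ T b → b ≡ false
¬T⇒≡false {false} _  = refl
¬T⇒≡false {true}  ¬t = ⊥-elim (¬t _)

∧≡true : ∀ {a b} → a ≡ true → b ≡ true → (a ∧ b) ≡ true
∧≡true refl refl = refl

∧≡true⁻ : ∀ {a b} → (a ∧ b) ≡ true → a ≡ true × b ≡ true
∧≡true⁻ {true} {true} _ = refl , refl

module _ {m n : ℕ} where

  ≡ᵇ≡true : m ≡ n → (m ≡ᵇ n) ≡ true
  ≡ᵇ≡true = T⇒≡true ∘ ≡⇒≡ᵇ m n

  ≡ᵇ≡true⁻ : (m ≡ᵇ n) ≡ true → m ≡ n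
  ≡ᵇ≡true⁻ = ≡ᵇ⇒≡ m n ∘ ≡true⇒T

  ≡ᵇ≡false : m ≢ n → (m ≡ᵇ n) ≡ false
  ≡ᵇ≡false m≢n = ¬T⇒≡false (m≢n ∘ ≡ᵇ⇒≡ m n)

  ≡ᵇ≡false⁻ : (m ≡ᵇ n) ≡ false → m ≢ n
  ≡ᵇ≡false⁻ eq m≡n = true≢false (trans (sym (≡ᵇ≡true m≡n)) eq)

  <ᵇ≡true : m < n → (m <ᵇ n) ≡ true
  <ᵇ≡true = T⇒≡true ∘ <⇒<ᵇ

  <ᵇ≡true⁻ : (m <ᵇ n) ≡ true → m < n
  <ᵇ≡true⁻ = <ᵇ⇒< m n ∘ ≡true⇒T

  <ᵇ≡false : n ≤ m → (m <ᵇ n) ≡ false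
  <ᵇ≡false n≤m = ¬T⇒≡false (≤⇒≯ n≤m ∘ <ᵇ⇒< m n)

  ≤ᵇ≡true : m ≤ n → (m ≤ᵇ n) ≡ true
  ≤ᵇ≡true = T⇒≡true ∘ ≤⇒≤ᵇ

  ≤ᵇ≡true⁻ : (m ≤ᵇ n) ≡ true → m ≤ n
  ≤ᵇ≡true⁻ = ≤ᵇ⇒≤ m n ∘ ≡true⇒T

  ≤ᵇ≡false : n < m → (m ≤ᵇ n) ≡ false
  ≤ᵇ≡false n<m = ¬T⇒≡false (<⇒≱ n<m ∘ ≤ᵇ⇒≤ m n)

Precedes : List A → A → A → Set
Precedes {A} L x y =
  Σ (List A) λ xs → Σ (List A) λ ys → Σ (List A) λ zs → L ≡ xs ++ x ∷ ys ++ y ∷ zs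

Precedes-lookup : (L : List A) {i j : Fin (length L)} → toℕ i < toℕ j → Precedes L (lookup L i) (lookup L j)
Precedes-lookup (x ∷ L) {zero} {suc j} _ =
  let ys , zs , eq = ∈-∃++ (∈-lookup {xs = L} j) in [] , ys , zs , cong (x ∷_) eq
Precedes-lookup (x ∷ L) {suc i} {suc j} (s≤s i<j) =
  let xs , ys , zs , eq = Precedes-lookup L i<j in x ∷ xs , ys , zs , cong (x ∷_) eq

Precedes-indices : (L : List A) {x y : A} → Precedes L x y →
  ∃₂ λ i j → toℕ i < toℕ j × lookup L i ≡ x × lookup L j ≡ y
Precedes-indices _ ([] , ys , zs , refl) =
  let m = ∈-++⁺ʳ ys (here refl) in zero , suc (Any.index m) , s≤s z≤n , refl , sym (lookup-index m)
Precedes-indices _ (w ∷ xs , ys , zs , refl) =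
  let i , j , i<j , eqi , eqj = Precedes-indices _ (xs , ys , zs , refl) in suc i , suc j , s≤s i<j , eqi , eqj

Precedes-∈ : ∀ {L : List A} {x y} → Precedes L x y → x ∈ L × y ∈ L
Precedes-∈ (xs , ys , zs , refl) = ∈-++⁺ʳ xs (here refl) , ∈-++⁺ʳ xs (there (∈-++⁺ʳ ys (here refl)))

module _ {L : List A} (unique : Unique L) where

  Precedes⇒index< : ∀ {i j} → Precedes L (lookup L i) (lookup L j) → toℕ i < toℕ j
  Precedes⇒index< prec =
    let i , j , i<j , eqi , eqj = Precedes-indices L prec in
    subst₂ (λ a b → toℕ a < toℕ b) (lookup-injective unique eqi) (lookup-injective unique eqj) i<j

  Precedes-asym : ∀ {x y} → Precedes L x y → ¬ Precedes L y x
  Precedes-asym xy yx with i , j , i<j , refl , refl ← Precedes-indices L xy = <-asym i<j (Precedes⇒index< yx)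

AllPairs-Precedes : (L : List A) → AllPairs (Precedes L) L
AllPairs-Precedes L =
  subst (AllPairs (Precedes L)) (tabulate-lookup L) (tabulate⁺-< (Precedes-lookup L))

-- Noncrossing bipartite trees

-- Reversing both vertex orders (↓) preserves noncrossing, so each argument about a crossing
-- is written once, for an orientation.
data Orientation : Set where
  ↑ ↓ : Orientation

_<[_]_ : ℕ → Orientation → ℕ → Set
m <[ ↑ ] n = m < n
m <[ ↓ ] n = n < m

compare[_] : ∀ d m n → Tri (m <[ d ] n) (m ≡ n) (n <[ d ] m)
compare[ ↑ ] m n = <-cmp m n
compare[ ↓ ] m n with <-cmp m n
... | tri< m<n m≢n m≯n = tri> m≯n m≢n m<n
... | tri≈ m≮n m≡n m≯n = tri≈ m≯n m≡n m≮n
... | tri> m≮n m≢n m>n = tri< m>n m≢n m≮n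

<[_]-irrefl : ∀ d {m} → ¬ m <[ d ] m
<[ ↑ ]-irrefl = <-irrefl refl
<[ ↓ ]-irrefl = <-irrefl refl

<[_]-trans : ∀ d {k m n} → k <[ d ] m → m <[ d ] n → k <[ d ] n
<[ ↑ ]-trans k<m m<n = <-trans k<m m<n
<[ ↓ ]-trans m<k n<m = <-trans n<m m<k

module _ {ℓ r : ℕ} where

  Noncrossing : (Fin ℓ → Fin r → Bool) → Set
  Noncrossing U = ∀ p t q u → U p q ≡ true → U t u ≡ true → toℕ p < toℕ t → ¬ toℕ u < toℕ q

  Crossing : Orientation → Fin ℓ → Fin r → Fin ℓ → Fin r → Set
  Crossing d a b p q = toℕ a <[ d ] toℕ p × toℕ q <[ d ] toℕ b

  noncrossing[_] : ∀ d {U} → Noncrossing U →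
                   ∀ {p q t u} → U p q ≡ true → U t u ≡ true → ¬ Crossing d p q t u
  noncrossing[ ↑ ] nc {p} {q} {t} {u} Upq Utu (p<t , u<q) = nc p t q u Upq Utu p<t u<q
  noncrossing[ ↓ ] nc {p} {q} {t} {u} Upq Utu (t<p , q<u) = nc t p u q Utu Upq t<p q<u

module NoncrossingTree {G : Graph} {F : Framing G} {ℓ r : ℕ} {T : Fin ℓ → Fin r → Bool}
                       (tree : BNCTree G F T) where
  open BNCTree tree

  edge-at-left : Fin r → ∀ p → ∃[ q ] T p q ≡ true
  edge-at-left q₀ p with connected (inj₂ q₀) (inj₁ p)
  ... | b-rl p q Tpq _ = q , Tpq

  edge-at-right : Fin ℓ → ∀ q → ∃[ p ] T p q ≡ true
  edge-at-right p₀ q with connected (inj₁ p₀) (inj₂ q)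
  ... | b-lr p q Tpq _ = p , Tpq

  private
    edge≢non-edge : ∀ {x y x′ y′} → T x y ≡ true → T x′ y′ ≡ false →
                    toℕ x ≡ toℕ x′ → toℕ y ≡ toℕ y′ → ⊥
    edge≢non-edge Txy Tx′y′ x≡x′ y≡y′ with refl ← toℕ-injective x≡x′ | refl ← toℕ-injective y≡y′ =
      true≢false (trans (sym Txy) Tx′y′)

  -- If nothing crosses the non-edge (p , q), an edge (a , q) on one side of p and an edge
  -- (p , b) on the other side of q confine every walk from p beyond (p , q), away from q.
  module _ (d : Orientation) {p q} (Tpq : T p q ≡ false)
           (uncrossed : ∀ a b → T a b ≡ true → ¬ Crossing d a b p q)
           {a b} (Taq : T a q ≡ true) (a<p : toℕ a <[ d ] toℕ p)
                 (Tpb : T p b ≡ true) (q<b : toℕ q <[ d ] toℕ b) where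

    Beyond : Fin ℓ ⊎ Fin r → Set
    Beyond (inj₁ x) = ¬ toℕ x <[ d ] toℕ p
    Beyond (inj₂ y) = toℕ q <[ d ] toℕ y

    stays-beyond : ∀ {v} → BConn G F T (inj₁ p) v → Beyond v
    stays-beyond b-refl = <[ d ]-irrefl
    stays-beyond (b-rl x y Txy walk) x<p = uncrossed x y Txy (x<p , stays-beyond walk)
    stays-beyond (b-lr x y Txy walk) with compare[ d ] (toℕ y) (toℕ q) | compare[ d ] (toℕ x) (toℕ p)
    ... | tri> _ _ q<y | _              = q<y
    ... | _            | tri< x<p _ _   = ⊥-elim (stays-beyond walk x<p)
    ... | tri< y<q _ _ | tri≈ _ x≡p _   =
      ⊥-elim (noncrossing[ d ] noncrossing Taq Txy (subst (toℕ a <[ d ]_) (sym x≡p) a<p , y<q))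
    ... | tri< y<q _ _ | tri> _ _ p<x   =
      ⊥-elim (noncrossing[ d ] noncrossing Taq Txy (<[ d ]-trans a<p p<x , y<q))
    ... | tri≈ _ y≡q _ | tri> _ _ p<x   =
      ⊥-elim (noncrossing[ d ] noncrossing Tpb Txy (p<x , subst (_<[ d ] toℕ b) (sym y≡q) q<b))
    ... | tri≈ _ y≡q _ | tri≈ _ x≡p _   = ⊥-elim (edge≢non-edge Txy Tpq x≡p y≡q)

  private
    walk-to-crossing : ∀ d {p q a} → T p q ≡ false → (∀ a b → T a b ≡ true → ¬ Crossing d a b p q) →
                       T a q ≡ true → toℕ a <[ d ] toℕ p → BConn G F T (inj₁ p) (inj₂ q) → ⊥
    walk-to-crossing d {p} {q} {a} Tpq uncrossed Taq a<p walk
      with b , Tpb ← edge-at-left q p | compare[ d ] (toℕ b) (toℕ q)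
    ... | tri< b<q _ _ = noncrossing[ d ] noncrossing Taq Tpb (a<p , b<q)
    ... | tri≈ _ b≡q _ = edge≢non-edge Tpb Tpq refl b≡q
    ... | tri> _ _ q<b = <[ d ]-irrefl (stays-beyond d Tpq uncrossed Taq a<p Tpb q<b walk)

  non-edge-crossed : ∀ {p q} → T p q ≡ false → ¬ (∀ d a b → T a b ≡ true → ¬ Crossing d a b p q)
  non-edge-crossed {p} {q} Tpq uncrossed with connected (inj₁ p) (inj₂ q)
  ... | walk@(b-lr a _ Taq _) with <-cmp (toℕ a) (toℕ p)
  ...   | tri< a<p _ _ = walk-to-crossing ↑ Tpq (uncrossed ↑) Taq a<p walk
  ...   | tri> _ _ p<a = walk-to-crossing ↓ Tpq (uncrossed ↓) Taq p<a walk
  ...   | tri≈ _ a≡p _ = edge≢non-edge Taq Tpq a≡p refl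

-- Counting, and the staircase extension of a noncrossing relation

count : (A → Bool) → List A → ℕ
count p xs = length (filterᵇ p xs)

count-++ : ∀ (p : A → Bool) xs ys → count p (xs ++ ys) ≡ count p xs + count p ys
count-++ p xs ys = trans (cong length (filter-++ (T? ∘ p) xs ys)) (length-++ (filterᵇ p xs))

count-map : ∀ (p : B → Bool) (f : A → B) xs → count p (map f xs) ≡ count (p ∘ f) xs
count-map p f []       = refl
count-map p f (x ∷ xs) with p (f x)
... | true  = cong suc (count-map p f xs)
... | false = count-map p f xs

count-cartesianProduct : ∀ (p : A × B → Bool) xs ys →
  count p (cartesianProduct xs ys) ≡ sum (map (λ x → count (λ y → p (x , y)) ys) xs)
count-cartesianProduct p []       ys = refl
count-cartesianProduct p (x ∷ xs) ys =
  trans (count-++ p (map (x ,_) ys) _) (cong₂ _+_ (count-map p (x ,_) ys) (count-cartesianProduct p xs ys))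

tabulate-toℕ : ∀ n (h : ℕ → A) → tabulate {n = n} (h ∘ toℕ) ≡ applyUpTo h n
tabulate-toℕ zero    h = refl
tabulate-toℕ (suc n) h = cong (h 0 ∷_) (tabulate-toℕ n (h ∘ suc))

map-allFin : ∀ n (h : ℕ → A) → map (h ∘ toℕ) (allFin n) ≡ applyUpTo h n
map-allFin n h = trans (map-tabulate (λ i → i) (h ∘ toℕ)) (tabulate-toℕ n h)

count-allFin : ∀ n (p : ℕ → Bool) → count (p ∘ toℕ) (allFin n) ≡ count p (upTo n)
count-allFin n p = trans (sym (count-map p toℕ (allFin n))) (cong (count p) (map-allFin n (λ k → k)))

count-upTo-suc : ∀ (p : ℕ → Bool) n → count p (upTo (suc n)) ≡ count p (upTo n) + (if p n then 1 else 0)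
count-upTo-suc p n =
  trans (cong (count p) (sym (upTo-∷ʳ n)))
        (trans (count-++ p (upTo n) [ n ]) (cong (count p (upTo n) +_) count-singleton))
  where
  count-singleton : count p [ n ] ≡ (if p n then 1 else 0)
  count-singleton with p n
  ... | true  = refl
  ... | false = refl

Between : ℕ → ℕ → ℕ → Bool
Between a b x = (a ≤ᵇ x) ∧ (x ≤ᵇ b)

module _ {a b : ℕ} where

  count-Between-below : ∀ n → n ≤ a → count (Between a b) (upTo n) ≡ 0
  count-Between-below zero    _   = refl
  count-Between-below (suc n) n<a
    rewrite count-upTo-suc (Between a b) n | count-Between-below n (<⇒≤ n<a) | ≤ᵇ≡false {a} {n} n<a = refl

  count-Between-inside : ∀ n → a ≤ n → n ≤ suc b → count (Between a b) (upTo n) + a ≡ n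
  count-Between-inside zero    a≤0 _ = n≤0⇒n≡0 a≤0
  count-Between-inside (suc n) a≤n n≤b with m≤n⇒m<n∨m≡n a≤n
  ... | inj₂ refl = cong (_+ a) (count-Between-below (suc n) ≤-refl)
  ... | inj₁ (s≤s a≤n)
    rewrite count-upTo-suc (Between a b) n | ≤ᵇ≡true {a} {n} a≤n | ≤ᵇ≡true {n} {b} (≤-pred n≤b) =
    trans (trans (+-assoc _ 1 a) (+-suc _ a))
          (cong suc (count-Between-inside n a≤n (m≤n⇒m≤1+n (≤-pred n≤b))))

  count-Between-above : ∀ n → suc b ≤ n → count (Between a b) (upTo n) ≡ count (Between a b) (upTo (suc b))
  count-Between-above (suc n) b<n with m≤n⇒m<n∨m≡n b<n
  ... | inj₂ refl = refl
  ... | inj₁ (s≤s b<n)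
    rewrite count-upTo-suc (Between a b) n | ≤ᵇ≡false {n} {b} b<n | ∧-zeroʳ (a ≤ᵇ n) =
    trans (+-identityʳ _) (count-Between-above n b<n)

  count-Between : ∀ n → a ≤ suc b → suc b ≤ n → count (Between a b) (upTo n) + a ≡ suc b
  count-Between n a≤b b<n =
    trans (cong (_+ a) (count-Between-above n b<n)) (count-Between-inside (suc b) a≤b ≤-refl)

sum-telescope : ∀ {c g : ℕ → ℕ} → (∀ k → c k + g k ≡ suc (g (suc k))) →
                ∀ n → sum (applyUpTo c n) + g 0 ≡ n + g n
sum-telescope δ zero = refl
sum-telescope {c} {g} δ (suc n) = begin
  c 0 + s + g 0    ≡⟨ cong (_+ g 0) (+-comm (c 0) s) ⟩
  s + c 0 + g 0    ≡⟨ +-assoc s (c 0) (g 0) ⟩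
  s + (c 0 + g 0)  ≡⟨ cong (s +_) (δ 0) ⟩
  s + suc (g 1)    ≡⟨ +-suc s (g 1) ⟩
  suc (s + g 1)    ≡⟨ cong suc (sum-telescope (δ ∘ suc) n) ⟩
  suc n + g (suc n) ∎
  where
  open ≡-Reasoning
  s = sum (applyUpTo (c ∘ suc) n)

bracket : (g : ℕ → ℕ) → ∀ {x} n → g 0 ≤ x → x ≤ g (suc n) →
          ∃[ k ] k ≤ n × g k ≤ x × x ≤ g (suc k)
bracket g zero    g0≤x x≤g1 = 0 , z≤n , g0≤x , x≤g1
bracket g {x} (suc n) g0≤x x≤g with x ≤? g (suc n)
... | yes x≤g′ = let k , k≤n , lo , hi = bracket g n g0≤x x≤g′ in k , m≤n⇒m≤1+n k≤n , lo , hi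
... | no  x≰g′ = suc n , ≤-refl , <⇒≤ (≰⇒> x≰g′) , x≤g

module _ {G : Graph} {F : Framing G} {ℓ r : ℕ} {T : Fin ℓ → Fin r → Bool} where

  BConn-trans : ∀ {x y z} → BConn G F T x y → BConn G F T y z → BConn G F T x z
  BConn-trans c b-refl          = c
  BConn-trans c (b-lr p q t c′) = b-lr p q t (BConn-trans c c′)
  BConn-trans c (b-rl p q t c′) = b-rl p q t (BConn-trans c c′)

  BConn-sym : ∀ {x y} → BConn G F T x y → BConn G F T y x
  BConn-sym b-refl         = b-refl
  BConn-sym (b-lr p q t c) = BConn-trans (b-rl p q t b-refl) (BConn-sym c)
  BConn-sym (b-rl p q t c) = BConn-trans (b-lr p q t b-refl) (BConn-sym c)

module Staircase (G : Graph) (F : Framing G) {ℓ r : ℕ}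
                 (U : Fin (suc ℓ) → Fin (suc r) → Bool) (U-noncrossing : Noncrossing U) where

  pairs : List (Fin (suc ℓ) × Fin (suc r))
  pairs = cartesianProduct (allFin (suc ℓ)) (allFin (suc r))

  U-below : ℕ → Fin (suc ℓ) × Fin (suc r) → Bool
  U-below k (p , q) = (toℕ p <ᵇ k) ∧ U p q

  ends-below : ℕ → List ℕ
  ends-below k = map (toℕ ∘ proj₂) (filterᵇ (U-below k) pairs)

  -- Row p of the staircase is the interval [reach p , reach (suc p)]; the base r past the
  -- last row makes the last interval end at the last right vertex.
  reach : ℕ → ℕ
  reach k = max (if ℓ <ᵇ k then r else 0) (ends-below k)

  reach-ub : ∀ {k p q} → U p q ≡ true → toℕ p < k → toℕ q ≤ reach k
  reach-ub {k} {p} {q} Upq p<k = v≤max⁺ _ _ (inj₂ (Any.map ≤-reflexive (∈-map⁺ (toℕ ∘ proj₂)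
    (∈-filterᵇ⁺ {p = U-below k} (∈-cartesianProduct⁺ (∈-allFin p) (∈-allFin q))
                                (∧≡true (<ᵇ≡true p<k) Upq)))))

  reach-lub : ∀ k {c} → (if ℓ <ᵇ k then r else 0) ≤ c →
              (∀ p q → U p q ≡ true → toℕ p < k → toℕ q ≤ c) → reach k ≤ c
  reach-lub k {c} base≤c below = max≤v⁺ {xs = ends-below k} base≤c (All.tabulate λ x∈ →
    let (p , q) , pq∈ , x≡q = ∈-map⁻ (toℕ ∘ proj₂) x∈
        p<k , Upq = ∧≡true⁻ (proj₂ (∈-filterᵇ⁻ {p = U-below k} pq∈))
    in subst (_≤ c) (sym x≡q) (below p q Upq (<ᵇ≡true⁻ p<k)))

  reach-≤ : ∀ k → reach k ≤ r
  reach-≤ k = reach-lub k (base-≤ (ℓ <ᵇ k)) (λ _ q _ _ → ≤-pred (toℕ<n q))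
    where
    base-≤ : ∀ b → (if b then r else 0) ≤ r
    base-≤ true  = ≤-refl
    base-≤ false = z≤n

  reach-zero : reach 0 ≡ 0
  reach-zero = n≤0⇒n≡0 (reach-lub 0 z≤n (λ _ _ _ ()))

  reach-last : reach (suc ℓ) ≡ r
  reach-last = ≤-antisym (reach-≤ (suc ℓ))
    (subst (λ b → (if b then r else 0) ≤ reach (suc ℓ)) (<ᵇ≡true (n<1+n ℓ))
           (⊥≤max _ (ends-below (suc ℓ))))

  reach-mono : ∀ {k k′} → k ≤ k′ → reach k ≤ reach k′
  reach-mono {k} {k′} k≤k′ =
    reach-lub k (base-mono (ℓ <ᵇ k) refl) (λ _ _ Upq p<k → reach-ub Upq (<-≤-trans p<k k≤k′))
    where
    base-mono : ∀ b → (ℓ <ᵇ k) ≡ b → (if b then r else 0) ≤ reach k′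
    base-mono false _  = z≤n
    base-mono true  eq = subst (λ b → (if b then r else 0) ≤ reach k′)
                               (<ᵇ≡true (<-≤-trans (<ᵇ≡true⁻ eq) k≤k′)) (⊥≤max _ (ends-below k′))

  U-above-reach : ∀ {p q} → U p q ≡ true → reach (toℕ p) ≤ toℕ q
  U-above-reach {p} {q} Upq =
    reach-lub (toℕ p) (subst (λ b → (if b then r else 0) ≤ toℕ q) (sym (<ᵇ≡false (≤-pred (toℕ<n p)))) z≤n)
              (λ a b Uab a<p → ≮⇒≥ (U-noncrossing a p b q Uab Upq a<p))

  stair : Fin (suc ℓ) → Fin (suc r) → Bool
  stair p q = Between (reach (toℕ p)) (reach (suc (toℕ p))) (toℕ q)

  stair≡true : ∀ {p q} → reach (toℕ p) ≤ toℕ q → toℕ q ≤ reach (suc (toℕ p)) → stair p q ≡ true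
  stair≡true lo hi = ∧≡true (≤ᵇ≡true lo) (≤ᵇ≡true hi)

  stair-at : ∀ {p q k} → toℕ p ≡ k → reach k ≤ toℕ q → toℕ q ≤ reach (suc k) → stair p q ≡ true
  stair-at refl = stair≡true

  U⊆stair : ∀ p q → U p q ≡ true → stair p q ≡ true
  U⊆stair p q Upq = stair≡true (U-above-reach Upq) (reach-ub Upq ≤-refl)

  stair-noncrossing : Noncrossing stair
  stair-noncrossing p t q u Spq Stu p<t u<q =
    <⇒≱ u<q (≤-trans (≤ᵇ≡true⁻ (proj₂ (∧≡true⁻ Spq)))
                     (≤-trans (reach-mono p<t) (≤ᵇ≡true⁻ (proj₁ (∧≡true⁻ Stu)))))

  link : ∀ {k} (p p′ : Fin (suc ℓ)) → toℕ p ≡ k → toℕ p′ ≡ suc k →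
         BConn G F stair (inj₁ p) (inj₁ p′)
  link {k} p p′ p≡ p′≡ =
    b-rl p′ y (stair-at p′≡ (≤-reflexive (sym y≡)) (≤-trans (≤-reflexive y≡) (reach-mono (n≤1+n _))))
      (b-lr p y (stair-at p≡ (≤-trans (reach-mono (n≤1+n k)) (≤-reflexive (sym y≡))) (≤-reflexive y≡)) b-refl)
    where
    y : Fin (suc r)
    y = fromℕ< (s≤s (reach-≤ (suc k)))
    y≡ : toℕ y ≡ reach (suc k)
    y≡ = toℕ-fromℕ< (s≤s (reach-≤ (suc k)))

  left-connected : ∀ k (p : Fin (suc ℓ)) → toℕ p ≡ k → BConn G F stair (inj₁ zero) (inj₁ p)
  left-connected zero    zero _  = b-refl
  left-connected (suc k) p  p≡ =
    BConn-trans (left-connected k p⁻ (toℕ-fromℕ< k<)) (link p⁻ p (toℕ-fromℕ< k<) p≡)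
    where
    k< : k < suc ℓ
    k< = <-trans (n<1+n k) (subst (_< suc ℓ) p≡ (toℕ<n p))
    p⁻ : Fin (suc ℓ)
    p⁻ = fromℕ< k<

  connected-from-zero : ∀ v → BConn G F stair (inj₁ zero) v
  connected-from-zero (inj₁ p) = left-connected (toℕ p) p refl
  connected-from-zero (inj₂ q)
    with k , k≤ℓ , lo , hi ← bracket reach ℓ (subst (_≤ toℕ q) (sym reach-zero) z≤n)
                                              (subst (toℕ q ≤_) (sym reach-last) (≤-pred (toℕ<n q))) =
    b-lr p q (stair-at (toℕ-fromℕ< (s≤s k≤ℓ)) lo hi) (left-connected (toℕ p) p refl)
    where
    p : Fin (suc ℓ)
    p = fromℕ< (s≤s k≤ℓ)

  row-size : ℕ → ℕ
  row-size k = count (Between (reach k) (reach (suc k))) (upTo (suc r))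

  row-size-telescopes : ∀ k → row-size k + reach k ≡ suc (reach (suc k))
  row-size-telescopes k = count-Between (suc r) (m≤n⇒m≤1+n (reach-mono (n≤1+n k))) (s≤s (reach-≤ (suc k)))

  stair-edge-count : numEdges G F stair + 1 ≡ suc ℓ + suc r
  stair-edge-count = begin
    numEdges G F stair + 1
      ≡⟨ cong (_+ 1) (count-cartesianProduct (λ (p , q) → stair p q) (allFin (suc ℓ)) (allFin (suc r))) ⟩
    sum (map (λ p → count (stair p) (allFin (suc r))) (allFin (suc ℓ))) + 1
      ≡⟨ cong (λ xs → sum xs + 1) (map-cong row-count (allFin (suc ℓ))) ⟩
    sum (map (row-size ∘ toℕ) (allFin (suc ℓ))) + 1
      ≡⟨ cong (λ xs → sum xs + 1) (map-allFin (suc ℓ) row-size) ⟩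
    sum (applyUpTo row-size (suc ℓ)) + 1
      ≡⟨ cong (_+ 1) (sym (trans (cong (sum (applyUpTo row-size (suc ℓ)) +_) reach-zero) (+-identityʳ _))) ⟩
    sum (applyUpTo row-size (suc ℓ)) + reach 0 + 1
      ≡⟨ cong (_+ 1) (sum-telescope {g = reach} row-size-telescopes (suc ℓ)) ⟩
    suc ℓ + reach (suc ℓ) + 1
      ≡⟨ cong (λ k → suc ℓ + k + 1) reach-last ⟩
    suc ℓ + r + 1
      ≡⟨ trans (+-assoc (suc ℓ) r 1) (cong (suc ℓ +_) (+-comm r 1)) ⟩
    suc ℓ + suc r ∎
    where
    open ≡-Reasoning
    row-count : ∀ p → count (stair p) (allFin (suc r)) ≡ row-size (toℕ p)
    row-count p = count-allFin (suc r) (Between (reach (toℕ p)) (reach (suc (toℕ p))))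

  stair-tree : BNCTree G F stair
  stair-tree = record
    { connected   = λ x y → BConn-trans (BConn-sym (connected-from-zero x)) (connected-from-zero y)
    ; edge-count  = stair-edge-count
    ; noncrossing = stair-noncrossing
    }

extend-to-tree : ∀ {G F ℓ r} → Fin ℓ → Fin r → (U : Fin ℓ → Fin r → Bool) → Noncrossing U →
                 ∃[ T ] BNCTree G F T × (∀ p q → U p q ≡ true → T p q ≡ true)
extend-to-tree {G} {F} {suc ℓ} {suc r} _ _ U U-noncrossing = stair , stair-tree , U⊆stair
  where open Staircase G F U U-noncrossing

module Paths (G : Graph) (wf : WellFormed G) where
  open Graph G
  open WellFormed wf

  private variable
    a b c w : ℕ
    e : Edge G
    P Q : Path G

  LastTailBelow : ℕ → Path G → Set
  LastTailBelow i P = ∃₂ λ P′ e → P ≡ P′ ∷ʳ e × tl e < i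

  tl≡⇒<hd : tl e ≡ a → a < hd e
  tl≡⇒<hd {e} tl≡a = subst (_< hd e) tl≡a (tl<hd e)

  path-< : PathFT G a b P → a < b
  path-< (single e)   = tl<hd e
  path-< (cons e P-b) = <-trans (tl<hd e) (path-< P-b)

  path-≤n : PathFT G a b P → b ≤ n
  path-≤n (single e)   = hd-≤n e
  path-≤n (cons e P-b) = path-≤n P-b

  path-tl : PathFT G a b (e ∷ P) → tl e ≡ a
  path-tl (single e) = refl
  path-tl (cons e _) = refl

  path-nonempty : PathFT G a b P → P ≢ []
  path-nonempty () refl

  path-tail : PathFT G a b (e ∷ P) → P ≢ [] → PathFT G (hd e) b P
  path-tail (single e)   P≢[] = ⊥-elim (P≢[] refl)
  path-tail (cons e P-b) _    = P-b

  path-target-unique : ∀ {a′ b′} → PathFT G a b P → PathFT G a′ b′ P → b ≡ b′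
  path-target-unique (single e)   (single .e)   = refl
  path-target-unique (cons e P-b) (cons .e P-b′) = path-target-unique P-b P-b′

  path-heads : PathFT G a b P → All (λ e → a < hd e × hd e ≤ b) P
  path-heads (single e)   = (tl<hd e , ≤-refl) ∷ []
  path-heads (cons e P-b) = (tl<hd e , <⇒≤ (path-< P-b))
                          ∷ All.map (λ (a<h , h≤b) → <-trans (tl<hd e) a<h , h≤b) (path-heads P-b)

  path-∷ʳ : PathFT G a b P → tl e ≡ b → PathFT G a (hd e) (P ∷ʳ e)
  path-∷ʳ {e = e} (single e′)   tl≡b = cons e′ (subst (λ v → PathFT G v (hd e) [ e ]) tl≡b (single e))
  path-∷ʳ         (cons e′ P-b) tl≡b = cons e′ (path-∷ʳ P-b tl≡b)

  path-drop : ∀ P {e Q} → PathFT G a c (P ++ e ∷ Q) → PathFT G a b P → PathFT G b c (e ∷ Q)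
  path-drop (x ∷ [])     (cons .x R) (single .x) = R
  path-drop (x ∷ y ∷ P)  (cons .x R) (cons .x P-b) = path-drop (y ∷ P) R P-b

  path-last-hd : ∀ P → PathFT G a b (P ∷ʳ e) → hd e ≡ b
  path-last-hd []          (single e)  = refl
  path-last-hd (x ∷ [])    (cons .x R) = path-last-hd [] R
  path-last-hd (x ∷ y ∷ P) (cons .x R) = path-last-hd (y ∷ P) R

  path-init : ∀ P → PathFT G a b (P ∷ʳ e) → (P ≡ [] × tl e ≡ a) ⊎ PathFT G a (tl e) P
  path-init []          R           = inj₁ (refl , path-tl R)
  path-init (x ∷ [])    (cons .x R) = inj₂ (subst (λ v → PathFT G _ v [ x ]) (sym (path-tl R)) (single x))
  path-init (x ∷ y ∷ P) (cons .x R) with path-init (y ∷ P) R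
  ... | inj₂ R′ = inj₂ (cons x R′)

  path-last-tl< : PathFT G a b P → LastTailBelow b P
  path-last-tl< {P = P} P-b with initLast P
  ... | []       = case P-b of λ ()
  ... | P′ ∷ʳ′ e = P′ , e , refl , subst (tl e <_) (path-last-hd P′ P-b) (tl<hd e)

module Triangulations (G : Graph) (wf : WellFormed G) (F : Framing G) (isF : IsFraming G F) where
  open Graph G
  open WellFormed wf
  open Framing F
  open IsFraming isF
  open Paths G wf

  private variable
    i j v w : ℕ
    e f : Edge G
    P Q X Y : Path G
    x y : List (Edge G)

  -- The framing and the DKK order

  in-hd : Inner G v → e ∈ inOrd v → hd e ≡ v
  in-hd iv = Equivalence.to (in-exact _ iv _)

  hd-in : Inner G v → hd e ≡ v → e ∈ inOrd v
  hd-in iv = Equivalence.from (in-exact _ iv _)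

  out-tl : Inner G v → e ∈ outOrd v → tl e ≡ v
  out-tl iv = Equivalence.to (out-exact _ iv _)

  tl-out : Inner G v → tl e ≡ v → e ∈ outOrd v
  tl-out iv = Equivalence.from (out-exact _ iv _)

  outOrd-tl : Inner G v → ∀ q → tl (lookup (outOrd v) q) ≡ v
  outOrd-tl iv q = out-tl iv (∈-lookup q)

  InLess-++ : ∀ s t → InLess G F x y → InLess G F (x ++ s) (y ++ t)
  InLess-++ s t (here prec) = here prec
  InLess-++ s t (there x<y) = there (InLess-++ s t x<y)

  InLess-prefix : ∀ z → InLess G F x y → InLess G F (z ++ x) (z ++ y)
  InLess-prefix []      x<y = x<y
  InLess-prefix (e ∷ z) x<y = there (InLess-prefix z x<y)

  InLess-asym : All (λ e → Inner G (hd e)) x → InLess G F x y → ¬ InLess G F y x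
  InLess-asym (ie ∷ _) (here {e} {f} e<f) (here f<e) =
    Precedes-asym (in-unique _ ie) e<f
      (subst (λ v → Precedes (inOrd v) f e) (in-hd ie (proj₂ (Precedes-∈ e<f))) f<e)
  InLess-asym (ie ∷ _) (here e<e) (there _) = Precedes-asym (in-unique _ ie) e<e e<e
  InLess-asym (ie ∷ _) (there _) (here e<e) = Precedes-asym (in-unique _ ie) e<e e<e
  InLess-asym (_ ∷ inner) (there x<y) (there y<x) = InLess-asym inner x<y y<x

  infix 4 _≺_
  _≺_ : Path G → Path G → Set
  P ≺ Q = InLess G F (reverse P) (reverse Q)

  ≺-++ : ∀ X Y → P ≺ Q → X ++ P ≺ Y ++ Q
  ≺-++ {P} {Q} X Y P≺Q rewrite reverse-++ X P | reverse-++ Y Q = InLess-++ _ _ P≺Q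

  ≺-++ʳ : ∀ S → P ≺ Q → P ++ S ≺ Q ++ S
  ≺-++ʳ {P} {Q} S P≺Q rewrite reverse-++ P S | reverse-++ Q S = InLess-prefix (reverse S) P≺Q

  ≺-asym : PathFT G 1 v P → v < n → P ≺ Q → ¬ Q ≺ P
  ≺-asym {P = P} P-v v<n = InLess-asym (All.tabulate (All.lookup inner ∘ reverse⁻))
    where
    inner : All (λ e → Inner G (hd e)) P
    inner = All.map (λ (1<h , h≤v) → 1<h , <-≤-trans (s≤s h≤v) v<n) (path-heads P-v)

  -- The reduction process

  -- An incoming edge of j once the vertices below i are reduced, recorded as the path it sums.
  data Entry (i j : ℕ) : Path G → Set where
    unreduced : hd e ≡ j → i ≤ tl e → Entry i j [ e ]
    reduced   : PathFT G 1 j P → LastTailBelow i P → Entry i j P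

  Entry-path : Entry i i P → PathFT G 1 i P
  Entry-path (unreduced {e} refl i≤tl) = ⊥-elim (<⇒≱ (tl<hd e) i≤tl)
  Entry-path (reduced P-i _)           = P-i

  Entry-hd : Entry i j [ e ] → hd e ≡ j
  Entry-hd (unreduced hd≡j _)  = hd≡j
  Entry-hd (reduced P-j _)     = path-last-hd [] P-j

  Entry-last-tl : ∀ {X} → Entry i j X → X ≡ P ∷ʳ e → P ≢ [] → tl e < i
  Entry-last-tl {P = P} (unreduced _ _) X≡ P≢[] = ⊥-elim (P≢[] (sym (proj₁ (∷ʳ-injective [] P X≡))))
  Entry-last-tl {P = P} (reduced _ (P′ , e′ , X≡′ , tl<i)) X≡ _ =
    subst (λ f → tl f < _) (proj₂ (∷ʳ-injective P′ P (trans (sym X≡′) X≡))) tl<i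

  record Invariant (i : ℕ) (In : State G F) : Set where
    field
      2≤i       : 2 ≤ i
      i≤n       : i ≤ n
      entries   : i ≤ j → P ∈ In j → Entry i j P
      originals : i ≤ tl e → [ e ] ∈ In (hd e)
      sorted    : i ≤ j → j < n → AllPairs _≺_ (In j)
      nonempty  : i ≤ j → j < n → ∃[ P ] P ∈ In j

  initial-inner : j < n → initial G F j ≡ map [_] (inOrd j)
  initial-inner {j} j<n =
    cong (if_then map [_] (inOrd j) else map [_] (filterᵇ (λ e → hd e ≡ᵇ j) (allFin m))) (<ᵇ≡true j<n)

  initial-outer : n ≤ j → initial G F j ≡ map [_] (filterᵇ (λ e → hd e ≡ᵇ j) (allFin m))
  initial-outer {j} n≤j =
    cong (if_then map [_] (inOrd j) else map [_] (filterᵇ (λ e → hd e ≡ᵇ j) (allFin m))) (<ᵇ≡false n≤j)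

  ∈-initial⁻ : 2 ≤ j → P ∈ initial G F j → ∃[ e ] P ≡ [ e ] × hd e ≡ j
  ∈-initial⁻ {j} 2≤j P∈ with j <? n
  ... | yes j<n = let e , e∈ , P≡ = ∈-map⁻ [_] (subst (_ ∈_) (initial-inner j<n) P∈) in
                  e , P≡ , in-hd (2≤j , j<n) e∈
  ... | no  j≮n = let e , e∈ , P≡ = ∈-map⁻ [_] (subst (_ ∈_) (initial-outer (≮⇒≥ j≮n)) P∈) in
                  e , P≡ , ≡ᵇ≡true⁻ (proj₂ (∈-filterᵇ⁻ {p = λ e → hd e ≡ᵇ j} {xs = allFin m} e∈))

  ∈-initial⁺ : ∀ e → [ e ] ∈ initial G F (hd e)
  ∈-initial⁺ e with hd e <? n
  ... | yes hd<n = subst (_ ∈_) (sym (initial-inner hd<n))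
                         (∈-map⁺ [_] (hd-in (≤-trans (s≤s (tl-≥1 e)) (tl<hd e) , hd<n) refl))
  ... | no  hd≮n = subst (_ ∈_) (sym (initial-outer (≮⇒≥ hd≮n)))
                         (∈-map⁺ [_] (∈-filterᵇ⁺ {p = λ f → hd f ≡ᵇ hd e} (∈-allFin e) (≡ᵇ≡true {hd e} refl)))

  initial-invariant : 2 ≤ n → Invariant 2 (initial G F)
  initial-invariant 2≤n = record
    { 2≤i       = ≤-refl
    ; i≤n       = 2≤n
    ; entries   = entries
    ; originals = λ {e} _ → ∈-initial⁺ e
    ; sorted    = sorted
    ; nonempty  = nonempty
    }
    where
    entries : 2 ≤ j → P ∈ initial G F j → Entry 2 j P
    entries 2≤j P∈ with ∈-initial⁻ 2≤j P∈
    ... | e , refl , hd≡j with m≤n⇒m<n∨m≡n (tl-≥1 e)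
    ...   | inj₁ 1<tl  = unreduced hd≡j 1<tl
    ...   | inj₂ 1≡tl  = reduced (subst₂ (λ a b → PathFT G a b [ e ]) (sym 1≡tl) hd≡j (single e))
                                 ([] , e , refl , s≤s (≤-reflexive (sym 1≡tl)))
    sorted : 2 ≤ j → j < n → AllPairs _≺_ (initial G F j)
    sorted 2≤j j<n = subst (AllPairs _≺_) (sym (initial-inner j<n))
      (AllPairs-map⁺ (AllPairs.map (λ {e} {f} e<f → here (subst (λ v → Precedes (inOrd v) e f)
                                  (sym (in-hd (2≤j , j<n) (proj₁ (Precedes-∈ e<f)))) e<f))
                                   (AllPairs-Precedes (inOrd _))))
    nonempty : 2 ≤ j → j < n → ∃[ P ] P ∈ initial G F j
    nonempty 2≤j j<n = let e , hd≡j = has-in _ (2≤j , j<n) in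
      [ e ] , subst (_ ∈_) (sym (initial-inner j<n)) (∈-map⁺ [_] (hd-in (2≤j , j<n) hd≡j))

  -- every prefix of R that has become a single edge (into an unreduced vertex) is present
  Survives : ℕ → State G F → Path G → Set
  Survives i In R = ∀ {A B w} → R ≡ A ++ B → PathFT G 1 w A → LastTailBelow i A → i ≤ w → A ∈ In w

  path-not-startsAt : 2 ≤ i → PathFT G 1 j P → startsAt G F i P ≡ false
  path-not-startsAt {P = []}    _   ()
  path-not-startsAt {P = _ ∷ _} 2≤i P-j = ≡ᵇ≡false (λ tl≡i → <⇒≢ 2≤i (trans (sym (path-tl P-j)) tl≡i))

  module Reduction (i : ℕ) (In : State G F) (T : Fin (length (In i)) → Fin (length (outOrd i)) → Bool) where

    inᵢ : Fin (length (In i)) → Path G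
    inᵢ = lookup (In i)

    outᵢ : Fin (length (outOrd i)) → Edge G
    outᵢ = lookup (outOrd i)

    Out : State G F
    Out = reduce G F i In T

    -- block and expand restate the where-clauses of reduce, so Out j ≡ concatMap expand (In j)
    block : Path G → Fin (length (outOrd i)) → List (Path G)
    block P q = if ⌊ ≡-dec Fin._≟_ [ outᵢ q ] P ⌋
                then map (λ p → inᵢ p ++ P) (filterᵇ (λ p → T p q) (allFin _))
                else []

    expand : Path G → List (Path G)
    expand P = if startsAt G F i P then concatMap (block P) (allFin _) else [ P ]

    ∈-block⁻ : ∀ {q} → X ∈ block P q → ∃[ p ] X ≡ inᵢ p ++ P × T p q ≡ true × [ outᵢ q ] ≡ P
    ∈-block⁻ {P = P} {q} X∈ with ≡-dec Fin._≟_ [ outᵢ q ] P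
    ... | yes out≡P =
      let p , p∈ , X≡ = ∈-map⁻ (λ p → inᵢ p ++ P) X∈ in
      p , X≡ , proj₂ (∈-filterᵇ⁻ {p = λ p → T p q} {xs = allFin _} p∈) , out≡P

    ∈-expand⁻ : X ∈ expand P → (X ≡ P × startsAt G F i P ≡ false) ⊎
                               (∃₂ λ p q → X ≡ inᵢ p ∷ʳ outᵢ q × T p q ≡ true × [ outᵢ q ] ≡ P)
    ∈-expand⁻ {P = P} X∈ with startsAt G F i P
    ... | false with here X≡P ← X∈ = inj₁ (X≡P , refl)
    ... | true  = let q , _ , X∈′ = ∈-concatMap-witness {f = block P} {xs = allFin _} X∈
                      p , X≡ , Tpq , out≡P = ∈-block⁻ X∈′
                  in inj₂ (p , q , trans X≡ (cong (inᵢ p ++_) (sym out≡P)) , Tpq , out≡P)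

    ∈-reduce⁻ : X ∈ Out j → (X ∈ In j × startsAt G F i X ≡ false) ⊎
                            (∃₂ λ p q → X ≡ inᵢ p ∷ʳ outᵢ q × T p q ≡ true × [ outᵢ q ] ∈ In j)
    ∈-reduce⁻ X∈ with P , P∈ , X∈′ ← ∈-concatMap-witness {f = expand} X∈ | ∈-expand⁻ X∈′
    ... | inj₁ (refl , starts) = inj₁ (P∈ , starts)
    ... | inj₂ (p , q , X≡ , Tpq , refl) = inj₂ (p , q , X≡ , Tpq , P∈)

    expand-kept : startsAt G F i P ≡ false → expand P ≡ [ P ]
    expand-kept {P} starts = cong (if_then concatMap (block P) (allFin _) else [ P ]) starts

    expand-joined : startsAt G F i P ≡ true → expand P ≡ concatMap (block P) (allFin _)
    expand-joined {P} starts = cong (if_then concatMap (block P) (allFin _) else [ P ]) starts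

    ∈-reduce⁺-kept : P ∈ In j → startsAt G F i P ≡ false → P ∈ Out j
    ∈-reduce⁺-kept P∈ starts =
      ∈-concatMap-intro {f = expand} P∈ (subst (_ ∈_) (sym (expand-kept starts)) (here refl))

    ∈-reduce⁺-joined : ∀ {p q} → [ outᵢ q ] ∈ In j → tl (outᵢ q) ≡ i → T p q ≡ true →
                       inᵢ p ∷ʳ outᵢ q ∈ Out j
    ∈-reduce⁺-joined {p = p} {q} out∈ tl≡i Tpq = ∈-concatMap-intro {f = expand} {y = inᵢ p ∷ʳ outᵢ q} out∈
      (subst (inᵢ p ∷ʳ outᵢ q ∈_) (sym (expand-joined (≡ᵇ≡true tl≡i)))
             (∈-concatMap-intro {f = block [ outᵢ q ]} (∈-allFin q) in-block))
      where
      in-block : inᵢ p ∷ʳ outᵢ q ∈ block [ outᵢ q ] q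
      in-block with ≡-dec Fin._≟_ [ outᵢ q ] [ outᵢ q ]
      ... | yes _   = ∈-map⁺ (λ p → inᵢ p ++ [ outᵢ q ]) (∈-filterᵇ⁺ (∈-allFin p) Tpq)
      ... | no  ¬refl = ⊥-elim (¬refl refl)

    expand-suffix : X ∈ expand P → ∃[ Y ] X ≡ Y ++ P
    expand-suffix X∈ with ∈-expand⁻ X∈
    ... | inj₁ (X≡P , _)                = [] , X≡P
    ... | inj₂ (p , q , X≡ , _ , out≡P) = inᵢ p , trans X≡ (cong (inᵢ p ++_) out≡P)

    reduce-sorted : Unique (outOrd i) → AllPairs _≺_ (In i) → AllPairs _≺_ (In j) → AllPairs _≺_ (Out j)
    reduce-sorted unique sortedᵢ = AllPairs-concatMap expand expand-sorted across
      where
      across : ∀ {P Q} → P ≺ Q → ∀ {X Y} → X ∈ expand P → Y ∈ expand Q → X ≺ Y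
      across P≺Q X∈ Y∈ with X′ , refl ← expand-suffix X∈ | Y′ , refl ← expand-suffix Y∈ = ≺-++ X′ Y′ P≺Q

      block-sorted : ∀ P q → AllPairs _≺_ (block P q)
      block-sorted P q with ≡-dec Fin._≟_ [ outᵢ q ] P
      ... | yes _ =
        AllPairs-map⁺ (AllPairs.map (λ {p} {p′} p<p′ → ≺-++ʳ {inᵢ p} {inᵢ p′} P (AllPairs-lookup sortedᵢ p<p′))
                                    (AllPairs-filter⁺ (T? ∘ λ p → T p q) (tabulate⁺-< (λ p<p′ → p<p′))))
      ... | no  _ = []

      blocks-disjoint : ∀ {P q q′} → toℕ q < toℕ q′ → ∀ {X Y} → X ∈ block P q → Y ∈ block P q′ → X ≺ Y
      blocks-disjoint q<q′ X∈ Y∈ =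
        let _ , _ , _ , out≡P  = ∈-block⁻ X∈
            _ , _ , _ , out′≡P = ∈-block⁻ Y∈
        in ⊥-elim (<-irrefl (cong toℕ (lookup-injective unique (∷-injectiveˡ (trans out≡P (sym out′≡P))))) q<q′)

      expand-sorted : ∀ P → AllPairs _≺_ (expand P)
      expand-sorted P with startsAt G F i P
      ... | false = [] ∷ []
      ... | true  =
        AllPairs-concatMap (block P) (block-sorted P) blocks-disjoint (tabulate⁺-< (λ q<q′ → q<q′))

    RespectsTree : Path G → Set
    RespectsTree R = ∀ {p q Y} → R ≡ (inᵢ p ∷ʳ outᵢ q) ++ Y → T p q ≡ true

    module _ (inv : Invariant i In) (i<n : i < n) where
      open Invariant inv

      inner-i : Inner G i
      inner-i = 2≤i , i<n

      outᵢ-tl : ∀ q → tl (outᵢ q) ≡ i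
      outᵢ-tl = outOrd-tl inner-i

      inᵢ-path : ∀ p → PathFT G 1 i (inᵢ p)
      inᵢ-path p = Entry-path (entries ≤-refl (∈-lookup p))

      some-inᵢ : Fin (length (In i))
      some-inᵢ = proj₁ (lookup-∈ (proj₂ (nonempty ≤-refl i<n)))

      some-outᵢ : Fin (length (outOrd i))
      some-outᵢ = proj₁ (lookup-∈ (tl-out inner-i (proj₂ (has-out i inner-i))))

      entries′ : suc i ≤ j → P ∈ Out j → Entry (suc i) j P
      entries′ i<j P∈ with ∈-reduce⁻ P∈
      ... | inj₁ (P∈ , starts) with entries (<⇒≤ i<j) P∈
      ...   | unreduced hd≡j i≤tl = unreduced hd≡j (≤∧≢⇒< i≤tl (≢-sym (≡ᵇ≡false⁻ starts)))
      ...   | reduced P-j (P′ , e , P≡ , tl<i) = reduced P-j (P′ , e , P≡ , m≤n⇒m≤1+n tl<i)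
      entries′ i<j _ | inj₂ (p , q , refl , _ , out∈) =
        reduced (subst (λ v → PathFT G 1 v _) (Entry-hd (entries (<⇒≤ i<j) out∈))
                       (path-∷ʳ (inᵢ-path p) (outᵢ-tl q)))
                (inᵢ p , outᵢ q , refl , s≤s (≤-reflexive (outᵢ-tl q)))

      originals′ : suc i ≤ tl e → [ e ] ∈ Out (hd e)
      originals′ i<tl = ∈-reduce⁺-kept (originals (<⇒≤ i<tl)) (≡ᵇ≡false (≢-sym (<⇒≢ i<tl)))

      sorted′ : suc i ≤ j → j < n → AllPairs _≺_ (Out j)
      sorted′ i<j j<n = reduce-sorted (out-unique i inner-i) (sorted ≤-refl i<n) (sorted (<⇒≤ i<j) j<n)

      nonempty′ : BNCTree G F T → suc i ≤ j → j < n → ∃[ P ] P ∈ Out j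
      nonempty′ {j} tree i<j j<n with nonempty (<⇒≤ i<j) j<n
      ... | P , P∈ with entries (<⇒≤ i<j) P∈
      ...   | reduced P-j _ = P , ∈-reduce⁺-kept P∈ (path-not-startsAt 2≤i P-j)
      ...   | unreduced {e} _ i≤tl with m≤n⇒m<n∨m≡n i≤tl
      ...     | inj₁ i<tl = P , ∈-reduce⁺-kept P∈ (≡ᵇ≡false (≢-sym (<⇒≢ i<tl)))
      ...     | inj₂ i≡tl =
        let q , out≡e = lookup-∈ (tl-out inner-i (sym i≡tl))
            p , Tpq   = NoncrossingTree.edge-at-right tree some-inᵢ q
        in _ , ∈-reduce⁺-joined (subst (λ f → [ f ] ∈ In j) (sym out≡e) P∈) (outᵢ-tl q) Tpq

      invariant-step : BNCTree G F T → Invariant (suc i) Out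
      invariant-step tree = record
        { 2≤i       = m≤n⇒m≤1+n 2≤i
        ; i≤n       = i<n
        ; entries   = entries′
        ; originals = originals′
        ; sorted    = sorted′
        ; nonempty  = nonempty′ tree
        }

      survives-step : ∀ {R} → RespectsTree R → Survives i In R → Survives (suc i) Out R
      survives-step respects survives {B = B} R≡ A-w (A′ , e , refl , tl<si) si≤w
        with m≤n⇒m<n∨m≡n (≤-pred tl<si)
      ... | inj₁ tl<i =
        ∈-reduce⁺-kept (survives R≡ A-w (A′ , e , refl , tl<i) (<⇒≤ si≤w)) (path-not-startsAt 2≤i A-w)
      ... | inj₂ tl≡i with path-init A′ A-w
      ...   | inj₁ (_ , tl≡1) = ⊥-elim (<⇒≢ 2≤i (trans (sym tl≡1) tl≡i))
      ...   | inj₂ A′-tl =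
        let A′-i       = subst (λ v → PathFT G 1 v A′) tl≡i A′-tl
            A′∈        = survives (trans R≡ (∷ʳ-++ A′ e B)) A′-i (path-last-tl< A′-i) ≤-refl
            p , inᵢp≡  = lookup-∈ A′∈
            q , outᵢq≡ = lookup-∈ (tl-out inner-i tl≡i)
            Tpq        = respects (trans R≡ (cong₂ (λ X f → (X ∷ʳ f) ++ B) (sym inᵢp≡) (sym outᵢq≡)))
            joined     = ∈-reduce⁺-joined (originals (≤-reflexive (sym (outᵢ-tl q)))) (outᵢ-tl q) Tpq
        in subst₂ (λ X v → X ∈ Out v) (cong₂ _∷ʳ_ inᵢp≡ outᵢq≡)
                  (trans (cong hd outᵢq≡) (path-last-hd A′ A-w)) joined

      survivor-uses-tree : ∀ {R B} → Survives (suc i) Out R → R ≡ P ++ e ∷ B → PathFT G 1 i P → tl e ≡ i →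
                           ∃₂ λ p q → inᵢ p ≡ P × outᵢ q ≡ e × T p q ≡ true
      survivor-uses-tree {P} {e} {B = B} survives R≡ P-i tl≡i
        with ∈-reduce⁻ (survives (trans R≡ (sym (∷ʳ-++ P e B))) (path-∷ʳ P-i tl≡i)
                                 (P , e , refl , s≤s (≤-reflexive tl≡i)) (tl≡⇒<hd tl≡i))
      ... | inj₂ (p , q , P∷ʳe≡ , Tpq , _) =
        let P≡ , e≡ = ∷ʳ-injective P _ P∷ʳe≡ in p , q , sym P≡ , sym e≡ , Tpq
      ... | inj₁ (P∷ʳe∈ , _) =
        ⊥-elim (<⇒≢ (Entry-last-tl (entries (<⇒≤ (tl≡⇒<hd tl≡i)) P∷ʳe∈) refl (path-nonempty P-i)) tl≡i)

      survives-back : ∀ {R} → Route G R → Survives (suc i) Out R → Survives i In R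
      survives-back R-n survives {A} {B} R≡ A-w (A′ , e , A≡ , tl<i) i≤w with m≤n⇒m<n∨m≡n i≤w
      ... | inj₁ i<w with ∈-reduce⁻ (survives R≡ A-w (A′ , e , A≡ , m≤n⇒m≤1+n tl<i) i<w)
      ...   | inj₁ (A∈ , _) = A∈
      ...   | inj₂ (p , q , A≡′ , _ , _) =
        ⊥-elim (<⇒≢ (subst (λ f → tl f < i) (proj₂ (∷ʳ-injective A′ _ (trans (sym A≡) A≡′))) tl<i) (outᵢ-tl q))
      survives-back R-n survives {A} {[]} R≡ A-w _ _ | inj₂ refl =
        ⊥-elim (<⇒≢ i<n (path-target-unique A-w (subst (Route G) (trans R≡ (++-identityʳ A)) R-n)))
      survives-back R-n survives {A} {_ ∷ _} R≡ A-w _ _ | inj₂ refl =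
        let p , _ , inₚ≡A , _ =
              survivor-uses-tree survives R≡ A-w (path-tl (path-drop A (subst (Route G) R≡ R-n) A-w))
        in subst (_∈ In i) inₚ≡A (∈-lookup p)

      joined-entry : ∀ {p q} → T p q ≡ true →
        inᵢ p ∷ʳ outᵢ q ∈ Out (hd (outᵢ q)) × PathFT G 1 (hd (outᵢ q)) (inᵢ p ∷ʳ outᵢ q) × i < hd (outᵢ q)
      joined-entry {p} {q} Tpq =
        ∈-reduce⁺-joined (originals (≤-reflexive (sym (outᵢ-tl q)))) (outᵢ-tl q) Tpq ,
        path-∷ʳ (inᵢ-path p) (outᵢ-tl q) ,
        tl≡⇒<hd (outᵢ-tl q)

      inᵢ-≺ : ∀ {p t} → toℕ p < toℕ t → inᵢ p ≺ inᵢ t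
      inᵢ-≺ = AllPairs-lookup (sorted ≤-refl i<n)

      outᵢ-OutLess : ∀ {q u X Y} → toℕ q < toℕ u → OutLess G F (outᵢ q ∷ X) (outᵢ u ∷ Y)
      outᵢ-OutLess {q} {u} q<u =
        here (subst (λ v → Precedes (outOrd v) (outᵢ q) (outᵢ u)) (sym (outᵢ-tl q))
                    (Precedes-lookup (outOrd i) q<u))

      split-through : ∀ {R p q Y} → Route G R → R ≡ (inᵢ p ∷ʳ outᵢ q) ++ Y →
                      Split G F i R (inᵢ p) (outᵢ q ∷ Y)
      split-through {p = p} {q} {Y} R-n R≡ =
        let R≡′ = trans R≡ (∷ʳ-++ (inᵢ p) (outᵢ q) Y) in
        R≡′ , inᵢ-path p , path-drop (inᵢ p) (subst (Route G) R≡′ R-n) (inᵢ-path p)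

      crossing⇒incoherent : ∀ {R R′ p q t u Y Y′} → Route G R → Route G R′ →
        R ≡ (inᵢ p ∷ʳ outᵢ q) ++ Y → R′ ≡ (inᵢ t ∷ʳ outᵢ u) ++ Y′ →
        toℕ p < toℕ t → toℕ u < toℕ q → ¬ Coherent G F R R′
      crossing⇒incoherent R-n R′-n R≡ R′≡ p<t u<q coh =
        proj₁ (coh i _ _ _ _ (split-through R-n R≡) (split-through R′-n R′≡)) (inᵢ-≺ p<t , outᵢ-OutLess u<q)

      no-inversion-at-i : BNCTree G F T → ∀ {R₁ R₂ P₁ P₂ Q₁ Q₂ e f} →
        Survives (suc i) Out R₁ → Survives (suc i) Out R₂ →
        Split G F i R₁ P₁ (e ∷ P₂) → Split G F i R₂ Q₁ (f ∷ Q₂) → P₁ ≺ Q₁ → ¬ Precedes (outOrd (tl f)) f e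
      no-inversion-at-i tree {P₁ = P₁} {Q₁ = Q₁} {e = e} {f} s₁ s₂
                        (R₁≡ , P₁-i , eP₂-n) (R₂≡ , Q₁-i , fQ₂-n) P₁≺Q₁ f<e
        with p₁ , q₁ , inp₁≡ , outq₁≡ , Tp₁q₁ ← survivor-uses-tree s₁ R₁≡ P₁-i (path-tl eP₂-n)
           | p₂ , q₂ , inp₂≡ , outq₂≡ , Tp₂q₂ ← survivor-uses-tree s₂ R₂≡ Q₁-i (path-tl fQ₂-n)
           | <-cmp (toℕ p₁) (toℕ p₂)
      ... | tri< p₁<p₂ _ _ = BNCTree.noncrossing tree p₁ p₂ q₁ q₂ Tp₁q₁ Tp₂q₂ p₁<p₂ q₂<q₁
        where
        q₂<q₁ : toℕ q₂ < toℕ q₁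
        q₂<q₁ = Precedes⇒index< (out-unique i inner-i)
                  (subst₂ (Precedes (outOrd i)) (sym outq₂≡) (sym outq₁≡)
                          (subst (λ v → Precedes (outOrd v) f e) (path-tl fQ₂-n) f<e))
      ... | tri≈ _ p₁≡p₂ _ = ≺-asym {Q = P₁} P₁-i i<n P₁≺P₁ P₁≺P₁
        where
        Q₁≡P₁ : Q₁ ≡ P₁
        Q₁≡P₁ = trans (sym inp₂≡) (trans (cong inᵢ (toℕ-injective (sym p₁≡p₂))) inp₁≡)
        P₁≺P₁ : P₁ ≺ P₁
        P₁≺P₁ = subst (P₁ ≺_) Q₁≡P₁ P₁≺Q₁
      ... | tri> _ _ p₂<p₁ = ≺-asym {Q = Q₁} P₁-i i<n P₁≺Q₁ (subst₂ _≺_ inp₂≡ inp₁≡ (inᵢ-≺ p₂<p₁))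

  Coherent-sym : Coherent G F P Q → Coherent G F Q P
  Coherent-sym coh v Q₁ Q₂ P₁ P₂ sQ sP = swap (coh v P₁ P₂ Q₁ Q₂ sP sQ)

  OutLess-nonempty : OutLess G F x y → x ≢ [] × y ≢ []
  OutLess-nonempty (here _)  = (λ ()) , (λ ())
  OutLess-nonempty (there _) = (λ ()) , (λ ())

  split-forward : Split G F v Y P (e ∷ Q) → Q ≢ [] → Split G F (hd e) Y (P ∷ʳ e) Q
  split-forward {P = P} {e} {Q} (Y≡ , P-v , eQ-n) Q≢[] =
    trans Y≡ (sym (∷ʳ-++ P e Q)) , path-∷ʳ P-v (path-tl eQ-n) , path-tail eQ-n Q≢[]

  invariant-reduce : ∀ {i In T} → Invariant i In → i < n → BNCTree G F T →
                     Invariant (suc i) (reduce G F i In T)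
  invariant-reduce {i} {In} {T} = Reduction.invariant-step i In T

  final-routes : ∀ {i In Fn} → Run G F i In Fn → Invariant i In → P ∈ Fn n → Route G P
  final-routes (done n≤i) inv P∈ with Invariant.entries inv (Invariant.i≤n inv) P∈
  ... | unreduced {e} hd≡n i≤tl = ⊥-elim (<⇒≱ (tl<hd e) (≤-trans (≤-reflexive hd≡n) (≤-trans n≤i i≤tl)))
  ... | reduced P-n _           = P-n
  final-routes (step i<n T tree run) inv P∈ = final-routes run (invariant-reduce inv i<n tree) P∈

  extends-to-final : ∀ {k In Fn} → Run G F k In Fn → Invariant k In →
                     P ∈ In j → k ≤ j → PathFT G 1 j P → ∃[ X ] P ++ X ∈ Fn n
  extends-to-final (done n≤k) inv P∈ k≤j P-j with ≤-antisym (path-≤n P-j) (≤-trans n≤k k≤j)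
  ... | refl = [] , subst (_∈ _) (sym (++-identityʳ _)) P∈
  extends-to-final {P = P} {k = k} {In = In} (step k<n T tree run) inv P∈ k≤j P-j with m≤n⇒m<n∨m≡n k≤j
  ... | inj₁ k<j =
    extends-to-final run inv′ (∈-reduce⁺-kept P∈ (path-not-startsAt (Invariant.2≤i inv) P-j)) k<j P-j
    where
    open Reduction k In T
    inv′ = invariant-reduce inv k<n tree
  ... | inj₂ refl =
    let a , inₐ≡P            = lookup-∈ P∈
        b , Tab              = NoncrossingTree.edge-at-left tree (some-outᵢ inv k<n) a
        joined , path , k<hd = joined-entry inv k<n Tab
        X , X∈               = extends-to-final run inv′ joined k<hd path
    in outᵢ b ∷ X , subst (_∈ _) (trans (∷ʳ-++ (inᵢ a) (outᵢ b) X) (cong (_++ outᵢ b ∷ X) inₐ≡P)) X∈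
    where
    open Reduction k In T
    inv′ = invariant-reduce inv k<n tree

  final-survives : ∀ {k In Fn R} → Run G F k In Fn → Invariant k In → R ∈ Fn n → Survives k In R
  final-survives {In = In} (done n≤k) inv R∈ {A} {[]} R≡ A-w _ k≤w =
    subst₂ (λ X v → X ∈ In v) (trans R≡ (++-identityʳ A)) (≤-antisym (≤-trans n≤k k≤w) (path-≤n A-w)) R∈
  final-survives (done n≤k) inv R∈ {A} {_ ∷ _} R≡ A-w _ k≤w =
    let R-n = final-routes (done n≤k) inv R∈ in
    ⊥-elim (<⇒≱ (path-< (path-drop A (subst (Route G) R≡ R-n) A-w)) (≤-trans n≤k k≤w))
  final-survives {k} {In} (step k<n T tree run) inv R∈ =
    Reduction.survives-back k In T inv k<n (final-routes (step k<n T tree run) inv R∈)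
                                           (final-survives run (invariant-reduce inv k<n tree) R∈)

  final-no-inversion : ∀ {i In Fn R₁ R₂ P₁ P₂ Q₁ Q₂} → Run G F i In Fn → Invariant i In → i ≤ v →
    R₁ ∈ Fn n → R₂ ∈ Fn n → Split G F v R₁ P₁ P₂ → Split G F v R₂ Q₁ Q₂ → P₁ ≺ Q₁ → ¬ OutLess G F Q₂ P₂
  final-no-inversion (done n≤i) _ i≤v _ _ (_ , _ , P₂-n) _ _ _ = <⇒≱ (path-< P₂-n) (≤-trans n≤i i≤v)
  final-no-inversion {v} {i} {In} {P₁ = P₁} {Q₁ = Q₁} (step i<n T tree run) inv i≤v R₁∈ R₂∈ s₁ s₂ P₁≺Q₁ Q₂<P₂
    with m≤n⇒m<n∨m≡n i≤v
  ... | inj₁ i<v = final-no-inversion run inv′ i<v R₁∈ R₂∈ s₁ s₂ P₁≺Q₁ Q₂<P₂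
    where inv′ = invariant-reduce inv i<n tree
  ... | inj₂ refl with Q₂<P₂
  ...   | here f<e =
    Reduction.no-inversion-at-i i In T inv i<n tree (final-survives run inv′ R₁∈) (final-survives run inv′ R₂∈)
                                s₁ s₂ P₁≺Q₁ f<e
    where inv′ = invariant-reduce inv i<n tree
  ...   | there {e} Q₂′<P₂′ =
    let Q₂′≢[] , P₂′≢[] = OutLess-nonempty Q₂′<P₂′ in
    final-no-inversion run inv′ (tl≡⇒<hd (path-tl (proj₂ (proj₂ s₁)))) R₁∈ R₂∈
      (split-forward s₁ P₂′≢[]) (split-forward s₂ Q₂′≢[]) (≺-++ʳ {P₁} {Q₁} [ e ] P₁≺Q₁) Q₂′<P₂′
    where inv′ = invariant-reduce inv i<n tree

  survivor-final : ∀ {i In R} → Invariant i In → n ≤ i → Route G R → Survives i In R → R ∈ In n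
  survivor-final inv n≤i R-n survives =
    let R′ , e , R≡ , tl<n = path-last-tl< R-n in
    survives (sym (++-identityʳ _)) R-n (R′ , e , R≡ , <-≤-trans tl<n n≤i) (Invariant.i≤n inv)

  initial-survives : ∀ {R} → Survives 2 (initial G F) R
  initial-survives _ A-w (A′ , e , refl , tl<2) _ with path-init A′ A-w
  ... | inj₁ (refl , _) = subst (λ v → [ e ] ∈ initial G F v) (path-last-hd [] A-w) (∈-initial⁺ e)
  ... | inj₂ A′-tl     = ⊥-elim (<⇒≱ (path-< A′-tl) (≤-pred tl<2))

  final-maximal : ∀ {i In Fn R} → Run G F i In Fn → Invariant i In → Route G R →
                  (∀ {P} → P ∈ Fn n → Coherent G F R P) → Survives i In R → R ∈ Fn n
  final-maximal (done n≤i) inv R-n _ survives = survivor-final inv n≤i R-n survives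
  final-maximal {i} {In} {Fn} {R} (step i<n T tree run) inv R-n coherent survives =
    final-maximal run inv′ R-n coherent (survives-step inv i<n respects survives)
    where
    open Reduction i In T
    inv′ : Invariant (suc i) Out
    inv′ = invariant-reduce inv i<n tree

    final-through : ∀ {a b} → T a b ≡ true → ∃₂ λ R′ X → R′ ∈ Fn n × Route G R′ × R′ ≡ (inᵢ a ∷ʳ outᵢ b) ++ X
    final-through Tab =
      let joined , path , i<hd = joined-entry inv i<n Tab
          X , R′∈             = extends-to-final run inv′ joined i<hd path
      in _ , X , R′∈ , final-routes run inv′ R′∈ , refl

    respects : RespectsTree R
    respects {p} {q} R≡ with T p q in Tpq
    ... | true  = refl
    ... | false = ⊥-elim (NoncrossingTree.non-edge-crossed tree Tpq uncrossed)
      where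
      uncrossed : ∀ d a b → T a b ≡ true → ¬ Crossing d a b p q
      uncrossed ↑ a b Tab (a<p , q<b) = let _ , _ , R′∈ , R′-n , R′≡ = final-through Tab in
        crossing⇒incoherent inv i<n R′-n R-n R′≡ R≡ a<p q<b (Coherent-sym (coherent R′∈))
      uncrossed ↓ a b Tab (p<a , b<q) = let _ , _ , R′∈ , R′-n , R′≡ = final-through Tab in
        crossing⇒incoherent inv i<n R-n R′-n R≡ R′≡ p<a b<q (coherent R′∈)

  -- The maximal cliques are the final route sets

  module Nondegenerate (2≤n : 2 ≤ n) where

    inv₀ : Invariant 2 (initial G F)
    inv₀ = initial-invariant 2≤n

    final-coherent : ∀ {Fn} → Run G F 2 (initial G F) Fn → P ∈ Fn n → Q ∈ Fn n → Coherent G F P Q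
    final-coherent run P∈ Q∈ v P₁ P₂ Q₁ Q₂ sP sQ =
      (λ (P₁≺Q₁ , Q₂<P₂) → final-no-inversion run inv₀ 2≤v P∈ Q∈ sP sQ P₁≺Q₁ Q₂<P₂) ,
      (λ (Q₁≺P₁ , P₂<Q₂) → final-no-inversion run inv₀ 2≤v Q∈ P∈ sQ sP Q₁≺P₁ P₂<Q₂)
      where
      2≤v : 2 ≤ v
      2≤v = path-< (proj₁ (proj₂ sP))

    PSSimplex⇒MaxClique : ∀ {S} → PSSimplex G F S → MaxClique G F S
    PSSimplex⇒MaxClique {S} (Fn , run , S⇔Fn) = record
      { routes  = All.tabulate λ P∈ → final-routes run inv₀ (to P∈)
      ; clique  = λ _ _ P∈ Q∈ → final-coherent run (to P∈) (to Q∈)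
      ; maximal = λ R R-n coherent →
          from (final-maximal run inv₀ R-n (λ P∈ → coherent _ (from P∈)) initial-survives)
      }
      where
      to : ∀ {P} → P ∈ S → P ∈ Fn n
      to {P} = Equivalence.to (S⇔Fn P)
      from : ∀ {P} → P ∈ Fn n → P ∈ S
      from {P} = Equivalence.from (S⇔Fn P)

    module _ {S} (max-clique : MaxClique G F S) where
      open MaxClique max-clique

      route : ∀ {R} → R ∈ S → Route G R
      route = All.lookup routes

      used : (i : ℕ) (In : State G F) → Fin (length (In i)) → Fin (length (outOrd i)) → Bool
      used i In p q = ⌊ any? (prefix? Fin._≟_ (lookup (In i) p ∷ʳ lookup (outOrd i) q)) S ⌋

      module _ {i : ℕ} {In : State G F} where
        open Reduction i In (used i In)

        used⁻ : ∀ {p q} → used i In p q ≡ true → ∃[ R ] R ∈ S × ∃[ Y ] R ≡ (inᵢ p ∷ʳ outᵢ q) ++ Y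
        used⁻ used≡ = let R , R∈ , prefix = find (toWitness (≡true⇒T used≡)) in R , R∈ , Prefix⇒++ prefix

        used⁺ : ∀ {p q R Y} → R ∈ S → R ≡ (inᵢ p ∷ʳ outᵢ q) ++ Y → used i In p q ≡ true
        used⁺ {p} {q} {Y = Y} R∈ R≡ =
          T⇒≡true (fromWitness (lose R∈ (subst (Prefix _≡_ _) (sym R≡) (++⇒Prefix (inᵢ p ∷ʳ outᵢ q) Y))))

        used-noncrossing : Invariant i In → i < n → Noncrossing (used i In)
        used-noncrossing inv i<n p t q u Upq Utu p<t u<q =
          let R₁ , R₁∈ , _ , R₁≡ = used⁻ Upq
              R₂ , R₂∈ , _ , R₂≡ = used⁻ Utu
          in crossing⇒incoherent inv i<n (route R₁∈) (route R₂∈) R₁≡ R₂≡ p<t u<q (clique _ _ R₁∈ R₂∈)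

      run-containing : ∀ k {i In} → k + i ≡ n → Invariant i In → (∀ {R} → R ∈ S → Survives i In R) →
                       ∃[ Fn ] Run G F i In Fn × (∀ {R} → R ∈ S → R ∈ Fn n)
      run-containing zero {i} {In} i≡n inv survive =
        In , done n≤i , λ R∈ → survivor-final inv n≤i (route R∈) (survive R∈)
        where
        n≤i = ≤-reflexive (sym i≡n)
      run-containing (suc k) {i} {In} k+i≡n inv survive =
        let T , tree , used⊆T =
              extend-to-tree (some-inᵢ inv i<n) (some-outᵢ inv i<n) (used i In) (used-noncrossing inv i<n)
            survive′ : ∀ {R} → R ∈ S → Survives (suc i) (reduce G F i In T) R
            survive′ R∈ =
              Reduction.survives-step i In T inv i<n (λ R≡ → used⊆T _ _ (used⁺ {i} {In} R∈ R≡)) (survive R∈)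
            Fn , run , S⊆Fn =
              run-containing k (trans (+-suc k i) k+i≡n) (invariant-reduce inv i<n tree) survive′
        in Fn , step i<n T tree run , S⊆Fn
        where
        open Reduction i In (used i In) using (some-inᵢ; some-outᵢ)
        i<n = subst (i <_) k+i≡n (s≤s (m≤n+m i k))

      MaxClique⇒PSSimplex : PSSimplex G F S
      MaxClique⇒PSSimplex =
        let Fn , run , S⊆Fn = run-containing (n ∸ 2) (m∸n+n≡m 2≤n) inv₀ (λ _ → initial-survives) in
        Fn , run , λ P → mk⇔ S⊆Fn λ P∈ →
          maximal P (final-routes run inv₀ P∈) (λ _ Q∈ → final-coherent run P∈ (S⊆Fn Q∈))

  module Edgeless (n<2 : n < 2) where

    no-edge : Edge G → ⊥
    no-edge e = <⇒≱ n<2 (≤-trans (≤-trans (s≤s (tl-≥1 e)) (tl<hd e)) (hd-≤n e))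

    no-path : ∀ {a b} → PathFT G a b P → ⊥
    no-path (single e) = no-edge e
    no-path (cons e _) = no-edge e

    no-final : ∀ {Fn} → Run G F 2 (initial G F) Fn → P ∈ Fn n → ⊥
    no-final (done _)         P∈ = no-edge (proj₁ (∈-map⁻ [_] (subst (_ ∈_) (initial-outer ≤-refl) P∈)))
    no-final (step 2<n _ _ _) _  = <-asym 2<n n<2

    triangulations-agree : ∀ S → MaxClique G F S ⇔ PSSimplex G F S
    triangulations-agree S = mk⇔
      (λ max-clique → initial G F , done (<⇒≤ n<2) , λ P →
         mk⇔ (⊥-elim ∘ no-path ∘ All.lookup (MaxClique.routes max-clique)) (⊥-elim ∘ no-final (done (<⇒≤ n<2))))
      (λ (Fn , run , S⇔Fn) → record
         { routes  = All.tabulate (⊥-elim ∘ no-final run ∘ Equivalence.to (S⇔Fn _))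
         ; clique  = λ P _ P∈ _ → ⊥-elim (no-final run (Equivalence.to (S⇔Fn P) P∈))
         ; maximal = λ _ R-n _ → ⊥-elim (no-path R-n)
         })

  triangulations-agree : ∀ S → MaxClique G F S ⇔ PSSimplex G F S
  triangulations-agree S with 2 ≤? n
  ... | yes 2≤n = mk⇔ MaxClique⇒PSSimplex PSSimplex⇒MaxClique
    where open Nondegenerate 2≤n
  ... | no  2≰n = Edgeless.triangulations-agree (≰⇒> 2≰n) S

theorem1p4 : (G : Graph) → WellFormed G → (F : Framing G) → IsFraming G F →
    Σ (Framing G) λ F' → IsFraming G F' ×
      (∀ (S : List (Path G)) → MaxClique G F S ⇔ PSSimplex G F' S)
theorem1p4 G wf F isF = F , isF , triangulations-agree
  where open Triangulations G wf F isF
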